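{- Let $G$ be a connected claw-free subcubic graph not isomorphic to the triangular prism, and let $S$ be a nonempty subset of $V(G)$. Let $R$ be an ordering of $E(G)$ compatible with $d_S$. Process the edges $e$ with $d_S(e)\ge 1$ in the order given by $R$, and assign to each such edge a color from $\{1,\dots,7\}$ different from the colors of all previously colored edges at distance $1$ or $2$ from it in $G$ (the greedy algorithm). Then at every step such a color exists, so the greedy algorithm produces a good partial coloring of $G$ in which exactly the edges $e$ with $d_S(e)<1$ are left uncolored.
   Context: A graph is claw-free if it has no induced $K_{1,3}$, and subcubic if its maximum degree is at most $3$. The triangular prism is the graph consisting of two disjoint triangles $a_1a_2a_3$, $b_1b_2b_3$ and the edges $a_ib_i$, $i=1,2,3$. Two distinct edges are at distance $1$ if they share an end vertex and at distance $2$ if they are not adjacent but both adjacent to a common edge. For $v\in V(G)$, $d_S(v)=\min_{w\in S} d(v,w)$, where $d(v,w)$ is the graph distance in $G$; for an edge $e=uv$, $d_S(e)=\tfrac12(d_S(u)+d_S(v))$. An ordering $(e_{k_1},\dots,e_{k_m})$ of $E(G)$ is compatible with $d_S$ if $i<j$ implies $d_S(e_{k_i})\ge d_S(e_{k_j})$. A good partial coloring of $G$ is a map $\phi$ from a subset of $E(G)$ to $\{1,\dots,7\}$ such that $\phi(e)\neq\phi(e')$ for any two colored edges $e,e'$ at distance $1$ or $2$ in $G$. -}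

module Defs where

open import Data.Nat using (ℕ; zero; suc; _+_; _≤_; _<_)
open import Data.Fin using (Fin; toℕ; _≟_) renaming (zero to f0; suc to fs)
open import Data.Fin.Subset using (Subset; _∈_; Nonempty)
open import Data.Bool using (Bool; true; false; if_then_else_)
open import Data.List using (List; map; allFin)
open import Data.Nat.ListAction using (sum)
open import Data.Maybe using (Maybe; just; nothing)
open import Data.Product using (Σ; ∃; _×_; _,_)
open import Data.Sum using (_⊎_)
open import Data.Empty using (⊥)
open import Relation.Nullary using (¬_; yes; no)
open import Relation.Binary.PropositionalEquality using (_≡_; _≢_)
open import Function.Bundles using (_↔_; Inverse)

module _ {n : ℕ} (adj : Fin n → Fin n → Bool) where

  Adj : Fin n → Fin n → Set
  Adj u v = adj u v ≡ true

  IsSimpleGraph : Set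
  IsSimpleGraph = (∀ u v → adj u v ≡ adj v u) × (∀ v → adj v v ≡ false)

  degree : Fin n → ℕ
  degree v = sum (map (λ w → if adj v w then 1 else 0) (allFin n))

  Subcubic : Set
  Subcubic = ∀ v → degree v ≤ 3

  ClawFree : Set
  ClawFree = ∀ (v a b c : Fin n) → Adj v a → Adj v b → Adj v c →
    a ≢ b → a ≢ c → b ≢ c →
    ¬ (¬ Adj a b × ¬ Adj a c × ¬ Adj b c)

  data Walk : Fin n → Fin n → ℕ → Set where
    here : ∀ {u} → Walk u u 0
    step : ∀ {u w v k} → Adj u w → Walk w v k → Walk u v (suc k)

  Connected : Set
  Connected = ∀ u v → ∃ λ k → Walk u v k

  IsDist : Fin n → Fin n → ℕ → Set
  IsDist u v k = Walk u v k × (∀ k' → Walk u v k' → k ≤ k')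

  IsDistS : Subset n → Fin n → ℕ → Set
  IsDistS S v m = (∃ λ w → w ∈ S × IsDist v w m)
                × (∀ w k → w ∈ S → IsDist v w k → m ≤ k)

  -- edges represented as (ordered) pairs of adjacent vertices
  VPair : Set
  VPair = Fin n × Fin n

  IsEdge : VPair → Set
  IsEdge (u , v) = Adj u v

  SameEdge : VPair → VPair → Set
  SameEdge (u , v) (u' , v') = (u ≡ u' × v ≡ v') ⊎ (u ≡ v' × v ≡ u')

  ShareEnd : VPair → VPair → Set
  ShareEnd (u , v) (u' , v') = (u ≡ u') ⊎ (u ≡ v') ⊎ (v ≡ u') ⊎ (v ≡ v')

  EdgeAdj : VPair → VPair → Set
  EdgeAdj e f = ¬ SameEdge e f × ShareEnd e f

  Dist1 : VPair → VPair → Set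
  Dist1 = EdgeAdj

  Dist2 : VPair → VPair → Set
  Dist2 e e' = ¬ SameEdge e e' × ¬ EdgeAdj e e'
             × (∃ λ f → IsEdge f × EdgeAdj e f × EdgeAdj f e')

  Near : VPair → VPair → Set
  Near e e' = Dist1 e e' ⊎ Dist2 e e'

  IsEdgeOrdering : (m : ℕ) → (Fin m → VPair) → Set
  IsEdgeOrdering m R = (∀ i → IsEdge (R i))
                     × (∀ i j → SameEdge (R i) (R j) → i ≡ j)
                     × (∀ e → IsEdge e → ∃ λ i → SameEdge (R i) e)

-- the triangular prism on Fin 6: triangles 0 1 2 and 3 4 5, edges i (i+3)
prismAdj : Fin 6 → Fin 6 → Bool
prismAdj u v = edge (toℕ u) (toℕ v)
  where
  edge : ℕ → ℕ → Bool
  edge 0 1 = true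
  edge 1 0 = true
  edge 0 2 = true
  edge 2 0 = true
  edge 1 2 = true
  edge 2 1 = true
  edge 3 4 = true
  edge 4 3 = true
  edge 3 5 = true
  edge 5 3 = true
  edge 4 5 = true
  edge 5 4 = true
  edge 0 3 = true
  edge 3 0 = true
  edge 1 4 = true
  edge 4 1 = true
  edge 2 5 = true
  edge 5 2 = true
  edge _ _ = false

IsoToPrism : {n : ℕ} → (Fin n → Fin n → Bool) → Set
IsoToPrism {n} adj = Σ (Fin n ↔ Fin 6) λ f →
  ∀ u v → adj u v ≡ prismAdj (Inverse.to f u) (Inverse.to f v)

-- Colors {1,…,7}, represented by Fin 7 (color c+1 ↔ element c).

Color : Set
Color = Fin 7

-- partial edge colorings, edges indexed by positions in the ordering
PColoring : ℕ → Set
PColoring m = Fin m → Maybe Color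

update : {m : ℕ} → Fin m → Color → PColoring m → PColoring m
update k c φ j with j ≟ k
... | yes _ = just c
... | no  _ = φ j

module _ {n : ℕ} (adj : Fin n → Fin n → Bool) {m : ℕ} (R : Fin m → VPair adj) where

  Good : PColoring m → Set
  Good φ = ∀ i j c → φ i ≡ just c → φ j ≡ just c → ¬ Near adj (R i) (R j)

  Available : PColoring m → Fin m → Color → Set
  Available φ k c = ∀ j c' → φ j ≡ just c' → Near adj (R j) (R k) → c' ≢ c

  module _ (dS : Fin n → ℕ) where

    -- 2·d_S(e) = d_S(u) + d_S(v)
    dS2 : VPair adj → ℕ
    dS2 (u , v) = dS u + dS v

    Compatible : Set
    Compatible = ∀ (i j : Fin m) → toℕ i < toℕ j → dS2 (R j) ≤ dS2 (R i)

    -- d_S(e) ≥ 1, i.e. d_S(u) + d_S(v) ≥ 2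
    Far : Fin m → Set
    Far i = 2 ≤ dS2 (R i)

    -- states reachable by the greedy algorithm after examining the first
    -- k edges of R (every run with every possible choice of colors)
    data GreedyReach : ℕ → PColoring m → Set where
      start : GreedyReach 0 (λ _ → nothing)
      skip  : ∀ {φ} (k : Fin m) → GreedyReach (toℕ k) φ → ¬ Far k →
              GreedyReach (suc (toℕ k)) φ
      paint : ∀ {φ} (k : Fin m) (c : Color) → GreedyReach (toℕ k) φ → Far k →
              Available φ k c → GreedyReach (suc (toℕ k)) (update k c φ)

-- Write weight(uv) = d_S(u) + d_S(v). When the greedy algorithm reaches a far edge uv, every
-- coloured edge is at least as heavy as uv (compatibility), so a colour is free as soon as at most
-- six edges near uv are at least as heavy. Every edge near uv has an end vertex h in
-- (N(u) ∪ N(v)) ∖ {u, v}, and at most three edges meet h, so it suffices to find two such hubs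
-- carrying all heavy near edges. A neighbour of u with smaller d_S carries only lighter edges.
-- If d_S(u) = d_S(v), both u and v have such a neighbour, leaving one hub on each side. If
-- d_S(v) = d_S(u) + 1, u has a lower neighbour w and at most one more neighbour a. If a ~ v the
-- hubs are a and the third neighbour of v; otherwise claw-freeness at u gives a ~ w, so only one
-- edge at a is heavy, while two further neighbours of v span a triangle with v by claw-freeness
-- at v, so their stars share an edge and six edges still suffice.

module Submission where

open import Defs
open import Data.Nat using (ℕ; zero; suc; _+_; _*_; _≤_; _<_; z≤n; s≤s)
open import Data.Nat.Properties
  using ( ≤-refl; ≤-trans; ≤-pred; ≤-antisym; ≤-reflexive; ≤-total; ≮⇒≥; <⇒≢; <⇒≱; <⇒≤; ≤∧≢⇒<
        ; 1+n≢n; 1+n≰n; n≤1+n; m≤n⇒m≤1+n; m<1+n⇒m<n∨m≡n; suc-injective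
        ; +-comm; +-suc; +-mono-≤; +-monoʳ-≤; *-suc; *-monoʳ-≤; anyUpTo? )
import Data.Nat as ℕ
open import Data.Nat.Induction using (<-rec)
open import Data.Fin using (Fin; toℕ; _≟_)
open import Data.Fin.Properties using (any?; pigeonhole; ¬∀⟶∃¬; toℕ-injective; toℕ<n)
open import Data.Fin.Subset using (Subset; Nonempty) renaming (_∈_ to _∈ₛ_)
open import Data.Bool using (Bool; true; false; if_then_else_)
import Data.Bool.Properties as Bool
open import Data.List using (List; []; _∷_; length; map; allFin; filter; concatMap; lookup; _++_)
open import Data.List.Properties using (length-map; length-++; filter-notAll)
open import Data.List.Membership.Propositional using (_∈_; _∉_)
open import Data.List.Membership.Propositional.Properties using (∈-allFin; ∈-filter⁺; ∈-filter⁻)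
open import Data.List.Relation.Unary.Any as Any using (Any; here; there; index)
open import Data.List.Relation.Unary.Any.Properties using (lookup-index; map⁺; concatMap⁺; ++⁺ˡ; ++⁺ʳ)
open import Data.Nat.ListAction using (sum)
open import Data.Maybe using (Maybe; just; nothing)
open import Data.Maybe.Properties using (just-injective; ≡-dec)
import Data.List.Membership.DecPropositional as DecMem
open import Data.List.Relation.Unary.Unique.Propositional using (Unique)
import Data.List.Relation.Unary.Unique.Propositional.Properties as Unique
open import Data.List.Relation.Unary.All using ([]; _∷_)
open import Data.List.Relation.Unary.AllPairs using ([]; _∷_)
open import Data.Product using (∃; _×_; _,_; proj₁; proj₂)
open import Data.Sum using (_⊎_; inj₁; inj₂)
open import Data.Empty using (⊥; ⊥-elim)
open import Relation.Nullary using (¬_; Dec; yes; no)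
open import Relation.Nullary.Decidable using (_×-dec_; _⊎-dec_; ¬?)
open import Relation.Binary.PropositionalEquality using (_≡_; _≢_; refl; sym; trans; cong; subst; ≢-sym; module ≡-Reasoning)
open ≡-Reasoning
open import Function.Definitions using (Injective)
open import Function.Bundles using (_⇔_; mk⇔)

image⊆⇒≤length : ∀ {k} {A : Set} (f : Fin k → A) → Injective _≡_ _≡_ f →
                 (xs : List A) → (∀ i → f i ∈ xs) → k ≤ length xs
image⊆⇒≤length {k} f f-inj xs f∈xs = ≮⇒≥ collision
  where
  collision : length xs < k → ⊥
  collision lt with pigeonhole lt (λ i → index (f∈xs i))
  ... | i , j , i<j , same-index = <⇒≢ i<j (cong toℕ (f-inj (begin
    f i                         ≡⟨ lookup-index (f∈xs i) ⟩
    lookup xs (index (f∈xs i))  ≡⟨ cong (lookup xs) same-index ⟩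
    lookup xs (index (f∈xs j))  ≡⟨ lookup-index (f∈xs j) ⟨
    f j                         ∎)))

∃∉ : ∀ {k} (xs : List (Maybe (Fin k))) → length xs < k → ∃ λ c → just c ∉ xs
∃∉ {k} xs lt = ¬∀⟶∃¬ k (λ c → just c ∈ xs) (λ c → DecMem._∈?_ (≡-dec _≟_) (just c) xs)
  (λ all∈ → <⇒≱ lt (image⊆⇒≤length just just-injective xs all∈))

n≤1+m⇒2≤m+n⇒1≤m : ∀ m {n} → n ≤ suc m → 2 ≤ m + n → 1 ≤ m
n≤1+m⇒2≤m+n⇒1≤m zero n≤1 2≤n = ⊥-elim (1+n≰n (≤-trans 2≤n n≤1))
n≤1+m⇒2≤m+n⇒1≤m (suc m) _ _ = s≤s z≤n

length≤1 : ∀ {X : Set} (xs : List X) → length xs ≤ 1 →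
           (∀ {z} → z ∉ xs) ⊎ ∃ λ a → a ∈ xs × ∀ {z} → z ∈ xs → z ≡ a
length≤1 [] _ = inj₁ λ ()
length≤1 (a ∷ []) _ = inj₂ (a , here refl , λ { (here z≡a) → z≡a })
length≤1 (_ ∷ _ ∷ _) (s≤s ())

unique-length≤2 : ∀ {X : Set} {xs : List X} → Unique xs → length xs ≤ 2 →
  length xs ≤ 1 ⊎ ∃ λ b₁ → ∃ λ b₂ → b₁ ≢ b₂ × b₁ ∈ xs × b₂ ∈ xs × (∀ {z} → z ∈ xs → z ≡ b₁ ⊎ z ≡ b₂)
unique-length≤2 {xs = []} _ _ = inj₁ z≤n
unique-length≤2 {xs = _ ∷ []} _ _ = inj₁ ≤-refl
unique-length≤2 {xs = b₁ ∷ b₂ ∷ []} ((b₁≢b₂ ∷ []) ∷ _) _ =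
  inj₂ (b₁ , b₂ , b₁≢b₂ , here refl , there (here refl) ,
        λ { (here z≡b₁) → inj₁ z≡b₁ ; (there (here z≡b₂)) → inj₂ z≡b₂ })
unique-length≤2 {xs = _ ∷ _ ∷ _ ∷ _} _ (s≤s (s≤s ()))

module Graph {n : ℕ} (adj : Fin n → Fin n → Bool) (simple : IsSimpleGraph adj) where

  A : Fin n → Fin n → Set
  A = Adj adj

  A? : ∀ u v → Dec (A u v)
  A? u v = adj u v Bool.≟ true

  A-sym : ∀ {u v} → A u v → A v u
  A-sym {u} {v} a = trans (proj₁ simple v u) a

  A-irrefl : ∀ {u v} → A u v → u ≢ v
  A-irrefl {u} a refl with trans (sym a) (proj₂ simple u)
  ... | ()

  infixl 6 _∖_
  _∖_ : List (Fin n) → Fin n → List (Fin n)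
  xs ∖ y = filter (λ z → ¬? (z ≟ y)) xs

  ∈-∖⁺ : ∀ {xs y z} → z ∈ xs → z ≢ y → z ∈ xs ∖ y
  ∈-∖⁺ = ∈-filter⁺ (λ z → ¬? (z ≟ _))

  ∈-∖⁻ : ∀ {xs y z} → z ∈ xs ∖ y → z ∈ xs × z ≢ y
  ∈-∖⁻ {xs} = ∈-filter⁻ (λ z → ¬? (z ≟ _)) {xs = xs}

  length-∖ : ∀ {xs y} → y ∈ xs → length (xs ∖ y) < length xs
  length-∖ {xs} y∈xs =
    filter-notAll (λ z → ¬? (z ≟ _)) xs (Any.map (λ y≡z z≢y → z≢y (sym y≡z)) y∈xs)

  neighbours : Fin n → List (Fin n)
  neighbours x = filter (A? x) (allFin n)

  ∈-neighbours⁺ : ∀ {x z} → A x z → z ∈ neighbours x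
  ∈-neighbours⁺ {x} {z} = ∈-filter⁺ (A? x) (∈-allFin z)

  ∈-neighbours⁻ : ∀ {x z} → z ∈ neighbours x → A x z
  ∈-neighbours⁻ {x} z∈ = proj₂ (∈-filter⁻ (A? x) {xs = allFin n} z∈)

  ∈-neighbours∖⁻ : ∀ {x y z} → z ∈ neighbours x ∖ y → A x z × z ≢ y
  ∈-neighbours∖⁻ {x} z∈ with ∈-∖⁻ {xs = neighbours x} z∈
  ... | z∈N , z≢y = ∈-neighbours⁻ z∈N , z≢y

  unique-neighbours∖ : ∀ x y → Unique (neighbours x ∖ y)
  unique-neighbours∖ x y = Unique.filter⁺ (λ z → ¬? (z ≟ y)) (Unique.filter⁺ (A? x) (Unique.allFin⁺ n))

  degree≡length-neighbours : ∀ x → degree adj x ≡ length (neighbours x)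
  degree≡length-neighbours x = count (allFin n)
    where
    count : ∀ xs → sum (map (λ w → if adj x w then 1 else 0) xs) ≡ length (filter (A? x) xs)
    count [] = refl
    count (w ∷ xs) with adj x w
    ... | true = cong suc (count xs)
    ... | false = count xs

  walk? : ∀ u v k → Dec (Walk adj u v k)
  walk? u v zero with u ≟ v
  ... | yes refl = yes here
  ... | no u≢v = no λ { here → u≢v refl }
  walk? u v (suc k) with any? (λ w → A? u w ×-dec walk? w v k)
  ... | yes (w , a , walk) = yes (step a walk)
  ... | no none = no λ { (step a walk) → none (_ , a , walk) }

  shortest-walk : ∀ {u v} L → Walk adj u v L → ∃ λ L₀ → IsDist adj u v L₀ × L₀ ≤ L
  shortest-walk {u} {v} = <-rec _ shorten
    where
    shorten : ∀ L → (∀ {k} → k < L → Walk adj u v k → ∃ λ L₀ → IsDist adj u v L₀ × L₀ ≤ k) →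
              Walk adj u v L → ∃ λ L₀ → IsDist adj u v L₀ × L₀ ≤ L
    shorten L rec walk with anyUpTo? (walk? u v) L
    ... | yes (k , k<L , walkₖ) with rec k<L walkₖ
    ...   | L₀ , dist , L₀≤k = L₀ , dist , ≤-trans L₀≤k (<⇒≤ k<L)
    shorten L rec walk | no none = L , (walk , λ k walkₖ → ≮⇒≥ λ k<L → none (k , k<L , walkₖ)) , ≤-refl

  VP : Set
  VP = VPair adj

  SE : VP → VP → Set
  SE = SameEdge adj

  SE-swap : ∀ {t o} → SE (t , o) (o , t)
  SE-swap = inj₂ (refl , refl)

  SE-swapˡ : ∀ {t o p} → SE (t , o) p → SE (o , t) p
  SE-swapˡ (inj₁ (p , q)) = inj₂ (q , p)
  SE-swapˡ (inj₂ (p , q)) = inj₁ (q , p)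

  SE-sym : ∀ {p q} → SE p q → SE q p
  SE-sym (inj₁ (p , q)) = inj₁ (sym p , sym q)
  SE-sym (inj₂ (p , q)) = inj₂ (sym q , sym p)

  SE-trans : ∀ {p q r} → SE p q → SE q r → SE p r
  SE-trans (inj₁ (refl , refl)) s = s
  SE-trans (inj₂ (refl , refl)) s = SE-swapˡ s

  ShareEnd-sym : ∀ {p q} → ShareEnd adj p q → ShareEnd adj q p
  ShareEnd-sym (inj₁ p) = inj₁ (sym p)
  ShareEnd-sym (inj₂ (inj₁ p)) = inj₂ (inj₂ (inj₁ (sym p)))
  ShareEnd-sym (inj₂ (inj₂ (inj₁ p))) = inj₂ (inj₁ (sym p))
  ShareEnd-sym (inj₂ (inj₂ (inj₂ p))) = inj₂ (inj₂ (inj₂ (sym p)))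

  EdgeAdj-sym : ∀ {p q} → EdgeAdj adj p q → EdgeAdj adj q p
  EdgeAdj-sym (¬same , share) = (λ s → ¬same (SE-sym s)) , ShareEnd-sym share

  Near-sym : ∀ {p q} → Near adj p q → Near adj q p
  Near-sym (inj₁ adjacent) = inj₁ (EdgeAdj-sym adjacent)
  Near-sym (inj₂ (¬same , ¬adjacent , f , f-edge , p~f , f~q)) =
    inj₂ ( (λ s → ¬same (SE-sym s)) , (λ a → ¬adjacent (EdgeAdj-sym a))
         , f , f-edge , EdgeAdj-sym f~q , EdgeAdj-sym p~f )

  Near⇒¬SE : ∀ {p q} → Near adj p q → ¬ SE p q
  Near⇒¬SE (inj₁ (¬same , _)) = ¬same
  Near⇒¬SE (inj₂ (¬same , _)) = ¬same

  EdgeNbr : Fin n → Fin n → Fin n → Set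
  EdgeNbr u v h = (A u h × h ≢ v) ⊎ (A v h × h ≢ u)

  EdgeNbr-sym : ∀ {u v h} → EdgeNbr u v h → EdgeNbr v u h
  EdgeNbr-sym (inj₁ x) = inj₂ x
  EdgeNbr-sym (inj₂ x) = inj₁ x

  EdgeAt : Fin n → VP → Set
  EdgeAt h e = ∃ λ z → A h z × SE e (h , z)

  EdgeAt-swap : ∀ {h t o} → EdgeAt h (t , o) → EdgeAt h (o , t)
  EdgeAt-swap (z , a , s) = z , a , SE-swapˡ s

  ClosedNbd : Fin n → Fin n → Fin n → Set
  ClosedNbd u v x = x ≡ u ⊎ x ≡ v ⊎ A u x ⊎ A v x

  closedNbd⇒EdgeNbr : ∀ {u v t o} → A t o → ¬ SE (t , o) (u , v) → ClosedNbd u v t →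
                      ∃ λ h → EdgeNbr u v h × EdgeAt h (t , o)
  closedNbd⇒EdgeNbr {u} {v} {t} {o} a ¬uv t∈ = go t∈
    where
    at-u : t ≡ u → ∃ λ h → EdgeNbr u v h × EdgeAt h (t , o)
    at-u refl = o , inj₁ (a , λ o≡v → ¬uv (inj₁ (refl , o≡v))) , t , A-sym a , SE-swap
    at-v : t ≡ v → ∃ λ h → EdgeNbr u v h × EdgeAt h (t , o)
    at-v refl = o , inj₂ (a , λ o≡u → ¬uv (inj₂ (refl , o≡u))) , t , A-sym a , SE-swap
    go : ClosedNbd u v t → ∃ λ h → EdgeNbr u v h × EdgeAt h (t , o)
    go (inj₁ t≡u) = at-u t≡u
    go (inj₂ (inj₁ t≡v)) = at-v t≡v
    go (inj₂ (inj₂ (inj₁ aut))) with t ≟ v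
    ... | yes t≡v = at-v t≡v
    ... | no t≢v = t , inj₁ (aut , t≢v) , o , a , inj₁ (refl , refl)
    go (inj₂ (inj₂ (inj₂ avt))) with t ≟ u
    ... | yes t≡u = at-u t≡u
    ... | no t≢u = t , inj₂ (avt , t≢u) , o , a , inj₁ (refl , refl)

  ShareEnd⇒ClosedNbd : ∀ {g₁ g₂ u v} → A g₁ g₂ → ShareEnd adj (g₁ , g₂) (u , v) →
                       ClosedNbd u v g₁ × ClosedNbd u v g₂
  ShareEnd⇒ClosedNbd a (inj₁ refl) = inj₁ refl , inj₂ (inj₂ (inj₁ a))
  ShareEnd⇒ClosedNbd a (inj₂ (inj₁ refl)) = inj₂ (inj₁ refl) , inj₂ (inj₂ (inj₂ a))
  ShareEnd⇒ClosedNbd a (inj₂ (inj₂ (inj₁ refl))) = inj₂ (inj₂ (inj₁ (A-sym a))) , inj₁ refl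
  ShareEnd⇒ClosedNbd a (inj₂ (inj₂ (inj₂ refl))) = inj₂ (inj₂ (inj₂ (A-sym a))) , inj₂ (inj₁ refl)

  Near⇒ClosedNbd : ∀ {t o u v} → Near adj (t , o) (u , v) → ClosedNbd u v t ⊎ ClosedNbd u v o
  Near⇒ClosedNbd (inj₁ (_ , inj₁ refl)) = inj₁ (inj₁ refl)
  Near⇒ClosedNbd (inj₁ (_ , inj₂ (inj₁ refl))) = inj₁ (inj₂ (inj₁ refl))
  Near⇒ClosedNbd (inj₁ (_ , inj₂ (inj₂ (inj₁ refl)))) = inj₂ (inj₁ refl)
  Near⇒ClosedNbd (inj₁ (_ , inj₂ (inj₂ (inj₂ refl)))) = inj₂ (inj₂ (inj₁ refl))
  Near⇒ClosedNbd (inj₂ (_ , _ , (g₁ , g₂) , a , (_ , e~f) , (_ , f~uv)))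
    with ShareEnd⇒ClosedNbd a f~uv | e~f
  ... | g₁∈ , _ | inj₁ refl = inj₁ g₁∈
  ... | _ , g₂∈ | inj₂ (inj₁ refl) = inj₁ g₂∈
  ... | g₁∈ , _ | inj₂ (inj₂ (inj₁ refl)) = inj₂ g₁∈
  ... | _ , g₂∈ | inj₂ (inj₂ (inj₂ refl)) = inj₂ g₂∈

  Near⇒EdgeAt-EdgeNbr : ∀ {t o u v} → A t o → Near adj (t , o) (u , v) →
                        ∃ λ h → EdgeNbr u v h × EdgeAt h (t , o)
  Near⇒EdgeAt-EdgeNbr a near with Near⇒ClosedNbd near
  ... | inj₁ t∈ = closedNbd⇒EdgeNbr a (Near⇒¬SE near) t∈
  ... | inj₂ o∈ with closedNbd⇒EdgeNbr (A-sym a) (λ s → Near⇒¬SE near (SE-swapˡ s)) o∈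
  ...   | h , nbr , at = h , nbr , EdgeAt-swap at

  SE-∈-map : ∀ {h z e xs} → SE e (h , z) → z ∈ xs → Any (SE e) (map (h ,_) xs)
  SE-∈-map s z∈xs = map⁺ (Any.map (λ { refl → s }) z∈xs)

  star : Fin n → List VP
  star h = map (h ,_) (neighbours h)

  star-covers : ∀ {h e} → EdgeAt h e → Any (SE e) (star h)
  star-covers (z , a , s) = SE-∈-map s (∈-neighbours⁺ a)

  stars : List (Fin n) → List VP
  stars = concatMap star

  stars-cover : ∀ {h e H} → h ∈ H → EdgeAt h e → Any (SE e) (stars H)
  stars-cover h∈H at = concatMap⁺ star (Any.map (λ { refl → star-covers at }) h∈H)

  module NeighbourCounts (subcubic : Subcubic adj) where

    length-neighbours : ∀ x → length (neighbours x) ≤ 3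
    length-neighbours x = subst (_≤ 3) (degree≡length-neighbours x) (subcubic x)

    length-neighbours∖ : ∀ {x y} → A x y → length (neighbours x ∖ y) ≤ 2
    length-neighbours∖ {x} a = ≤-pred (≤-trans (length-∖ (∈-neighbours⁺ a)) (length-neighbours x))

    length-neighbours∖∖ : ∀ {x y z} → A x y → A x z → y ≢ z → length (neighbours x ∖ y ∖ z) ≤ 1
    length-neighbours∖∖ a b y≢z =
      ≤-pred (≤-trans (length-∖ (∈-∖⁺ (∈-neighbours⁺ b) λ z≡y → y≢z (sym z≡y))) (length-neighbours∖ a))

    length-star : ∀ h → length (star h) ≤ 3
    length-star h = subst (_≤ 3) (sym (length-map (h ,_) (neighbours h))) (length-neighbours h)

    length-stars : ∀ H → length (stars H) ≤ 3 * length H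
    length-stars [] = z≤n
    length-stars (h ∷ H) = subst (_≤ 3 * length (h ∷ H)) (sym (length-++ (star h)))
      (subst (length (star h) + length (stars H) ≤_) (sym (*-suc 3 (length H)))
        (+-mono-≤ (length-star h) (length-stars H)))

  module Distance (S : Subset n) (dS : Fin n → ℕ) (isDistS : ∀ v → IsDistS adj S v (dS v)) where

    dS-walk : ∀ {v w L} → w ∈ₛ S → Walk adj v w L → dS v ≤ L
    dS-walk {v} {w} {L} w∈S walk with shortest-walk L walk
    ... | L₀ , dist , L₀≤L = ≤-trans (proj₂ (isDistS v) w L₀ w∈S dist) L₀≤L

    dS-adj : ∀ {x y} → A x y → dS x ≤ suc (dS y)
    dS-adj a with isDistS _
    ... | (w , w∈S , walk , _) , _ = dS-walk w∈S (step a walk)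

    dS-descent : ∀ {x} → 1 ≤ dS x → ∃ λ w → A x w × dS x ≡ suc (dS w)
    dS-descent {x} 1≤dS with isDistS x
    ... | (w , w∈S , walk , _) , _ = descend walk refl 1≤dS
      where
      descend : ∀ {k} → Walk adj x w k → dS x ≡ k → 1 ≤ k → ∃ λ y → A x y × dS x ≡ suc (dS y)
      descend (step {w = y} a walk) dS≡k _ =
        y , a , ≤-antisym (dS-adj a) (subst (suc (dS y) ≤_) (sym dS≡k) (s≤s (dS-walk w∈S walk)))

    -- twice the paper's d_S(e)
    weight : VP → ℕ
    weight (t , o) = dS t + dS o

    weight-SE : ∀ {e e'} → SE e e' → weight e ≡ weight e'
    weight-SE {t , o} (inj₁ (refl , refl)) = refl
    weight-SE {t , o} (inj₂ (refl , refl)) = +-comm (dS t) (dS o)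

    weight-EdgeAt : ∀ {h e} → EdgeAt h e → weight e ≤ dS h + suc (dS h)
    weight-EdgeAt {h} (z , a , s) =
      ≤-trans (≤-reflexive (weight-SE s)) (+-monoʳ-≤ (dS h) (dS-adj (A-sym a)))

  module HeavyEdges (subcubic : Subcubic adj) (clawFree : ClawFree adj)
                    (S : Subset n) (dS : Fin n → ℕ) (isDistS : ∀ v → IsDistS adj S v (dS v)) where
    open NeighbourCounts subcubic
    open Distance S dS isDistS

    Heavy : Fin n → Fin n → VP → Set
    Heavy u v e = weight (u , v) ≤ weight e

    HeavyCover : Fin n → Fin n → List VP → Set
    HeavyCover u v L = ∀ {h e} → EdgeNbr u v h → EdgeAt h e → Heavy u v e → Any (SE e) L

    SixCover : Fin n → Fin n → Set
    SixCover u v = ∃ λ L → length L ≤ 6 × HeavyCover u v L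

    Heavy-sym : ∀ {u v e} → Heavy u v e → Heavy v u e
    Heavy-sym {u} {v} {e} = subst (_≤ weight e) (+-comm (dS u) (dS v))

    SixCover-sym : ∀ {u v} → SixCover u v → SixCover v u
    SixCover-sym (L , len , cover) = L , len , λ nbr at heavy → cover (EdgeNbr-sym nbr) at (Heavy-sym heavy)

    sixCover-hubs : ∀ {u v} (H : List (Fin n)) → length H ≤ 2 →
      (∀ {h e} → EdgeNbr u v h → EdgeAt h e → Heavy u v e → h ∈ H) → SixCover u v
    sixCover-hubs H len hub =
      stars H , ≤-trans (length-stars H) (*-monoʳ-≤ 3 len) ,
      λ nbr at heavy → stars-cover (hub nbr at heavy) at

    light-hub : ∀ {u v h e} → EdgeAt h e → dS h + suc (dS h) < weight (u , v) → ¬ Heavy u v e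
    light-hub at light heavy = <⇒≱ light (≤-trans heavy (weight-EdgeAt at))

    sixCover-level : ∀ {u v w w'} → A u v → A u w → A v w' →
      dS u ≡ suc (dS w) → dS v ≡ suc (dS w) → dS w' ≡ dS w → SixCover u v
    sixCover-level {u} {v} {w} {w'} auv auw avw' du dv dw' = sixCover-hubs H length-H hub
      where
      H : List (Fin n)
      H = neighbours u ∖ v ∖ w ++ neighbours v ∖ u ∖ w'
      w-light : dS w + suc (dS w) < weight (u , v)
      w-light rewrite du | dv = ≤-refl
      w'-light : dS w' + suc (dS w') < weight (u , v)
      w'-light rewrite dw' = w-light
      v≢w : v ≢ w
      v≢w refl = 1+n≢n (sym dv)
      u≢w' : u ≢ w'
      u≢w' refl = 1+n≢n (sym (trans (sym dw') du))
      length-H : length H ≤ 2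
      length-H = subst (_≤ 2) (sym (length-++ (neighbours u ∖ v ∖ w)))
        (+-mono-≤ (length-neighbours∖∖ auv auw v≢w) (length-neighbours∖∖ (A-sym auv) avw' u≢w'))
      hub : ∀ {h e} → EdgeNbr u v h → EdgeAt h e → Heavy u v e → h ∈ H
      hub {h} (inj₁ (auh , h≢v)) at heavy with h ≟ w
      ... | yes refl = ⊥-elim (light-hub at w-light heavy)
      ... | no h≢w = ++⁺ˡ (∈-∖⁺ (∈-∖⁺ (∈-neighbours⁺ auh) h≢v) h≢w)
      hub {h} (inj₂ (avh , h≢u)) at heavy with h ≟ w'
      ... | yes refl = ⊥-elim (light-hub at w'-light heavy)
      ... | no h≢w' = ++⁺ʳ (neighbours u ∖ v ∖ w) (∈-∖⁺ (∈-∖⁺ (∈-neighbours⁺ avh) h≢u) h≢w')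

    module Ascending {u v w} (auv : A u v) (auw : A u w)
                     (du : dS u ≡ suc (dS w)) (dv : dS v ≡ suc (dS u)) where

      w-light : dS w + suc (dS w) < weight (u , v)
      w-light rewrite dv | du = s≤s (+-monoʳ-≤ (dS w) (n≤1+n _))

      two-below : suc (dS w) + suc (dS w) < weight (u , v)
      two-below rewrite dv | du = s≤s (≤-reflexive (sym (+-suc (dS w) (suc (dS w)))))

      ¬avw : ¬ A v w
      ¬avw avw = 1+n≰n (subst (_≤ suc (dS w)) (trans dv (cong suc du)) (dS-adj avw))

      v≢w : v ≢ w
      v≢w refl = 1+n≰n (subst (suc (dS v) ≤_) (sym (trans dv (cong suc du))) (n≤1+n _))

      u-hub : ∀ {h e} → A u h → h ≢ v → EdgeAt h e → Heavy u v e → h ∈ neighbours u ∖ v ∖ w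
      u-hub {h} auh h≢v at heavy with h ≟ w
      ... | yes refl = ⊥-elim (light-hub at w-light heavy)
      ... | no h≢w = ∈-∖⁺ (∈-∖⁺ (∈-neighbours⁺ auh) h≢v) h≢w

      sixCover-leaf : (∀ {h} → h ∉ neighbours u ∖ v ∖ w) → SixCover u v
      sixCover-leaf none = sixCover-hubs (neighbours v ∖ u) (length-neighbours∖ (A-sym auv)) hub
        where
        hub : ∀ {h e} → EdgeNbr u v h → EdgeAt h e → Heavy u v e → h ∈ neighbours v ∖ u
        hub (inj₁ (auh , h≢v)) at heavy = ⊥-elim (none (u-hub auh h≢v at heavy))
        hub (inj₂ (avh , h≢u)) _ _ = ∈-∖⁺ (∈-neighbours⁺ avh) h≢u

      module Branch {a} (a∈ : a ∈ neighbours u ∖ v ∖ w)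
                    (only-a : ∀ {h} → h ∈ neighbours u ∖ v ∖ w → h ≡ a) where

        a≢w : a ≢ w
        a≢w = proj₂ (∈-∖⁻ {xs = neighbours u ∖ v} a∈)

        aua : A u a
        aua = proj₁ (∈-neighbours∖⁻ (proj₁ (∈-∖⁻ {xs = neighbours u ∖ v} a∈)))

        a≢v : a ≢ v
        a≢v = proj₂ (∈-neighbours∖⁻ (proj₁ (∈-∖⁻ {xs = neighbours u ∖ v} a∈)))

        u≢a : u ≢ a
        u≢a = A-irrefl aua

        sixCover-triangle : A v a → SixCover u v
        sixCover-triangle ava = sixCover-hubs H (s≤s (length-neighbours∖∖ (A-sym auv) ava u≢a)) hub
          where
          H : List (Fin n)
          H = a ∷ neighbours v ∖ u ∖ a
          hub : ∀ {h e} → EdgeNbr u v h → EdgeAt h e → Heavy u v e → h ∈ H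
          hub (inj₁ (auh , h≢v)) at heavy = here (only-a (u-hub auh h≢v at heavy))
          hub {h} (inj₂ (avh , h≢u)) _ _ with h ≟ a
          ... | yes h≡a = here h≡a
          ... | no h≢a = there (∈-∖⁺ (∈-∖⁺ (∈-neighbours⁺ avh) h≢u) h≢a)

        module Apart (¬ava : ¬ A v a) (awa : A w a) where

          a-edges : ∀ {e} → EdgeAt a e → Heavy u v e → Any (SE e) (map (a ,_) (neighbours a ∖ u ∖ w))
          a-edges {e} (z , aaz , s) heavy = SE-∈-map s (∈-∖⁺ (∈-∖⁺ (∈-neighbours⁺ aaz) z≢u) z≢w)
            where
            low : dS z ≤ suc (dS w) → ⊥
            low dz = <⇒≱ two-below
              (≤-trans heavy (≤-trans (≤-reflexive (weight-SE s)) (+-mono-≤ (dS-adj (A-sym awa)) dz)))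
            z≢u : z ≢ u
            z≢u refl = low (≤-reflexive du)
            z≢w : z ≢ w
            z≢w refl = low (n≤1+n _)

          ¬aub : ∀ {b} → A v b → ¬ A u b
          ¬aub {b} avb aub with b ≟ v | b ≟ w
          ... | yes refl | _ = A-irrefl avb refl
          ... | no _ | yes refl = ¬avw avb
          ... | no b≢v | no b≢w with only-a (∈-∖⁺ (∈-∖⁺ (∈-neighbours⁺ aub) b≢v) b≢w)
          ...   | refl = ¬ava avb

          sixCover-few : length (neighbours v ∖ u) ≤ 1 → SixCover u v
          sixCover-few len = sixCover-hubs (a ∷ neighbours v ∖ u) (s≤s len) hub
            where
            hub : ∀ {h e} → EdgeNbr u v h → EdgeAt h e → Heavy u v e → h ∈ a ∷ neighbours v ∖ u
            hub (inj₁ (auh , h≢v)) at heavy = here (only-a (u-hub auh h≢v at heavy))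
            hub (inj₂ (avh , h≢u)) _ _ = there (∈-∖⁺ (∈-neighbours⁺ avh) h≢u)

          -- Claw-freeness at v makes v b₁ b₂ a triangle, so b₁b₂ is counted once.
          sixCover-two : ∀ {b₁ b₂} → b₁ ≢ b₂ → b₁ ∈ neighbours v ∖ u → b₂ ∈ neighbours v ∖ u →
                         (∀ {z} → z ∈ neighbours v ∖ u → z ≡ b₁ ⊎ z ≡ b₂) → SixCover u v
          sixCover-two {b₁} {b₂} b₁≢b₂ b₁∈ b₂∈ b₁-or-b₂ = L , length-L , cover
            where
            avb₁ : A v b₁
            avb₁ = proj₁ (∈-neighbours∖⁻ b₁∈)
            avb₂ : A v b₂
            avb₂ = proj₁ (∈-neighbours∖⁻ b₂∈)
            ab₁b₂ : A b₁ b₂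
            ab₁b₂ with A? b₁ b₂
            ... | yes a = a
            ... | no ¬a = ⊥-elim (clawFree v u b₁ b₂ (A-sym auv) avb₁ avb₂
                    (≢-sym (proj₂ (∈-neighbours∖⁻ b₁∈))) (≢-sym (proj₂ (∈-neighbours∖⁻ b₂∈))) b₁≢b₂
                    (¬aub avb₁ , ¬aub avb₂ , ¬a))
            Lₐ L₂ L : List VP
            Lₐ = map (a ,_) (neighbours a ∖ u ∖ w)
            L₂ = map (b₂ ,_) (neighbours b₂ ∖ b₁)
            L = Lₐ ++ star b₁ ++ L₂
            length-Lₐ : length Lₐ ≤ 1
            length-Lₐ = subst (_≤ 1) (sym (length-map (a ,_) (neighbours a ∖ u ∖ w)))
              (length-neighbours∖∖ (A-sym aua) (A-sym awa) (A-irrefl auw))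
            length-L₂ : length L₂ ≤ 2
            length-L₂ = subst (_≤ 2) (sym (length-map (b₂ ,_) (neighbours b₂ ∖ b₁)))
              (length-neighbours∖ (A-sym ab₁b₂))
            length-L : length L ≤ 6
            length-L = subst (_≤ 6) (sym (trans (length-++ Lₐ) (cong (length Lₐ +_) (length-++ (star b₁)))))
              (+-mono-≤ length-Lₐ (+-mono-≤ (length-star b₁) length-L₂))
            b₂-edges : ∀ {e} → EdgeAt b₂ e → Any (SE e) (star b₁ ++ L₂)
            b₂-edges (z , ab₂z , s) with z ≟ b₁
            ... | yes refl = ++⁺ˡ (star-covers (b₂ , ab₁b₂ , SE-trans s SE-swap))
            ... | no z≢b₁ = ++⁺ʳ (star b₁) (SE-∈-map s (∈-∖⁺ (∈-neighbours⁺ ab₂z) z≢b₁))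
            cover : HeavyCover u v L
            cover (inj₁ (auh , h≢v)) at heavy with only-a (u-hub auh h≢v at heavy)
            ... | refl = ++⁺ˡ (a-edges at heavy)
            cover (inj₂ (avh , h≢u)) at _ with b₁-or-b₂ (∈-∖⁺ (∈-neighbours⁺ avh) h≢u)
            ... | inj₁ refl = ++⁺ʳ Lₐ (++⁺ˡ (star-covers at))
            ... | inj₂ refl = ++⁺ʳ Lₐ (b₂-edges at)

        sixCover-branch : SixCover u v
        sixCover-branch with A? v a
        ... | yes ava = sixCover-triangle ava
        ... | no ¬ava with A? w a
        ...   | no ¬awa =
          ⊥-elim (clawFree u v w a auv auw aua v≢w (≢-sym a≢v) (≢-sym a≢w) (¬avw , ¬ava , ¬awa))
        ...   | yes awa with unique-length≤2 (unique-neighbours∖ v u) (length-neighbours∖ (A-sym auv))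
        ...     | inj₁ few = Apart.sixCover-few ¬ava awa few
        ...     | inj₂ (_ , _ , b₁≢b₂ , b₁∈ , b₂∈ , b₁-or-b₂) =
          Apart.sixCover-two ¬ava awa b₁≢b₂ b₁∈ b₂∈ b₁-or-b₂

      sixCover-ascending : SixCover u v
      sixCover-ascending with length≤1 (neighbours u ∖ v ∖ w) (length-neighbours∖∖ auv auw v≢w)
      ... | inj₁ none = sixCover-leaf none
      ... | inj₂ (a , a∈ , only-a) = Branch.sixCover-branch a∈ only-a

    sixCover-ordered : ∀ {u v} → A u v → dS u ≤ dS v → 2 ≤ weight (u , v) → SixCover u v
    sixCover-ordered {u} {v} auv u≤v far
      with dS-descent (n≤1+m⇒2≤m+n⇒1≤m (dS u) (dS-adj (A-sym auv)) far)
    ... | w , auw , du with dS v ℕ.≟ dS u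
    ...   | no dv≢du = Ascending.sixCover-ascending auv auw du
                         (≤-antisym (dS-adj (A-sym auv)) (≤∧≢⇒< u≤v (≢-sym dv≢du)))
    ...   | yes dv≡du with dS-descent (subst (1 ≤_) (sym (trans dv≡du du)) (s≤s z≤n))
    ...     | w' , avw' , dv = sixCover-level auv auw avw' du (trans dv≡du du)
                                 (suc-injective (trans (sym dv) (trans dv≡du du)))

    sixCover : ∀ {u v} → A u v → 2 ≤ weight (u , v) → SixCover u v
    sixCover {u} {v} auv far with ≤-total (dS u) (dS v)
    ... | inj₁ u≤v = sixCover-ordered auv u≤v far
    ... | inj₂ v≤u =
      SixCover-sym (sixCover-ordered (A-sym auv) v≤u (subst (2 ≤_) (+-comm (dS u) (dS v)) far))

    near-heavy-cover : ∀ {u v} → A u v → 2 ≤ weight (u , v) → ∃ λ L → length L ≤ 6 ×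
      ∀ {t o} → A t o → Near adj (t , o) (u , v) → Heavy u v (t , o) → Any (SE (t , o)) L
    near-heavy-cover auv far with sixCover auv far
    ... | L , len , cover = L , len , λ ato near heavy →
      let _ , nbr , at = Near⇒EdgeAt-EdgeNbr ato near in cover nbr at heavy

FewHeavyNear : ∀ {n} (adj : Fin n → Fin n → Bool) {m} → (Fin m → VPair adj) → (Fin n → ℕ) → Fin m → Set
FewHeavyNear adj R dS k = ∃ λ L → length L ≤ 6 ×
  ∀ j → Near adj (R j) (R k) → dS2 adj R dS (R k) ≤ dS2 adj R dS (R j) → Any (SameEdge adj (R j)) L

module Greedy {n : ℕ} (adj : Fin n → Fin n → Bool) (simple : IsSimpleGraph adj)
              {m : ℕ} (R : Fin m → VPair adj) (ordering : IsEdgeOrdering adj m R)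
              (dS : Fin n → ℕ) (compatible : Compatible adj R dS)
              (sparse : ∀ k → Far adj R dS k → FewHeavyNear adj R dS k)
              where
  open Graph adj simple using (SE; SE-sym; SE-trans; Near-sym; Near⇒¬SE)

  SE? : ∀ p q → Dec (SE p q)
  SE? (a , b) (c , d) = (a ≟ c ×-dec b ≟ d) ⊎-dec (a ≟ d ×-dec b ≟ c)

  colourOf : PColoring m → VPair adj → Maybe Color
  colourOf φ p with any? (λ i → SE? (R i) p)
  ... | yes (i , _) = φ i
  ... | no _ = nothing

  colourOf-SE : ∀ φ j {p} → SE (R j) p → colourOf φ p ≡ φ j
  colourOf-SE φ j {p} s with any? (λ i → SE? (R i) p)
  ... | yes (i , s') = cong φ (proj₁ (proj₂ ordering) i j (SE-trans s' (SE-sym s)))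
  ... | no none = ⊥-elim (none (j , s))

  record Invariant (t : ℕ) (φ : PColoring m) : Set where
    field
      coloured⇒examined : ∀ i c → φ i ≡ just c → toℕ i < t × Far adj R dS i
      examined⇒coloured : ∀ i → toℕ i < t → Far adj R dS i → ∃ λ c → φ i ≡ just c
      good : Good adj R φ

  invariant : ∀ {t φ} → GreedyReach adj R dS t φ → Invariant t φ
  invariant start = record
    { coloured⇒examined = λ _ _ ()
    ; examined⇒coloured = λ _ ()
    ; good = λ _ _ _ ()
    }
  invariant (skip {φ} k reach ¬far) = record
    { coloured⇒examined = λ i c φi → let i<k , far = coloured⇒examined i c φi in m≤n⇒m≤1+n i<k , far
    ; examined⇒coloured = examined
    ; good = good
    }
    where
    open Invariant (invariant reach)
    examined : ∀ i → toℕ i < suc (toℕ k) → Far adj R dS i → ∃ λ c → φ i ≡ just c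
    examined i i≤k far with m<1+n⇒m<n∨m≡n i≤k
    ... | inj₁ i<k = examined⇒coloured i i<k far
    ... | inj₂ i≡k = ⊥-elim (¬far (subst (Far adj R dS) (toℕ-injective i≡k) far))
  invariant (paint {φ} k c reach far available) = record
    { coloured⇒examined = coloured
    ; examined⇒coloured = examined
    ; good = good′
    }
    where
    open Invariant (invariant reach)
    φ′ : PColoring m
    φ′ = update k c φ
    coloured : ∀ i c′ → φ′ i ≡ just c′ → toℕ i < suc (toℕ k) × Far adj R dS i
    coloured i c′ φ′i with i ≟ k
    ... | yes refl = ≤-refl , far
    ... | no _ = let i<k , far-i = coloured⇒examined i c′ φ′i in m≤n⇒m≤1+n i<k , far-i
    examined : ∀ i → toℕ i < suc (toℕ k) → Far adj R dS i → ∃ λ c′ → φ′ i ≡ just c′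
    examined i i≤k far-i with i ≟ k
    ... | yes refl = c , refl
    ... | no i≢k with m<1+n⇒m<n∨m≡n i≤k
    ...   | inj₁ i<k = examined⇒coloured i i<k far-i
    ...   | inj₂ i≡k = ⊥-elim (i≢k (toℕ-injective i≡k))
    good′ : Good adj R φ′
    good′ i j c′ φ′i φ′j near with i ≟ k | j ≟ k
    ... | yes refl | yes refl = Near⇒¬SE near (inj₁ (refl , refl))
    ... | yes refl | no _ = available j c′ φ′j (Near-sym near) (just-injective (sym φ′i))
    ... | no _ | yes refl = available i c′ φ′i near (just-injective (sym φ′j))
    ... | no _ | no _ = good i j c′ φ′i φ′j near

  -- Edges coloured before R k are at least as heavy by compatibility, so sparse k bounds their colours.
  colour-available : ∀ k φ → GreedyReach adj R dS (toℕ k) φ → Far adj R dS k → ∃ λ c → Available adj R φ k c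
  colour-available k φ reach far with sparse k far
  ... | L , length-L , cover
    with ∃∉ (map (colourOf φ) L) (s≤s (≤-trans (≤-reflexive (length-map (colourOf φ) L)) length-L))
  ...   | c , c∉ = c , available
    where
    available : Available adj R φ k c
    available j c′ φj near refl
      with cover j near (compatible j k (proj₁ (Invariant.coloured⇒examined (invariant reach) j c′ φj)))
    ... | cover-j = c∉ (map⁺ (Any.map (λ s → sym (trans (colourOf-SE φ j s) φj)) cover-j))

  greedy-result : ∀ φ → GreedyReach adj R dS m φ →
                  Good adj R φ × (∀ i → (∃ λ c → φ i ≡ just c) ⇔ Far adj R dS i)
  greedy-result φ reach =
    good , λ i → mk⇔ (λ (c , φi) → proj₂ (coloured⇒examined i c φi)) (examined⇒coloured i (toℕ<n i))
    where open Invariant (invariant reach)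

lemma1 : ∀ {n : ℕ} (adj : Fin n → Fin n → Bool) →
    IsSimpleGraph adj → Connected adj → ClawFree adj → Subcubic adj →
    ¬ IsoToPrism adj →
    (S : Subset n) → Nonempty S →
    (dS : Fin n → ℕ) → (∀ v → IsDistS adj S v (dS v)) →
    (m : ℕ) (R : Fin m → VPair adj) → IsEdgeOrdering adj m R →
    Compatible adj R dS →
    (∀ (k : Fin m) (φ : PColoring m) → GreedyReach adj R dS (toℕ k) φ →
       Far adj R dS k → ∃ λ c → Available adj R φ k c)
    × (∀ (φ : PColoring m) → GreedyReach adj R dS m φ →
         Good adj R φ × (∀ i → (∃ λ c → φ i ≡ just c) ⇔ Far adj R dS i))
lemma1 adj simple _ clawFree subcubic _ S _ dS isDistS m R ordering compatible =
  colour-available , greedy-result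
  where
  open Graph adj simple using (module HeavyEdges)
  open HeavyEdges subcubic clawFree S dS isDistS using (near-heavy-cover)
  sparse : ∀ k → Far adj R dS k → FewHeavyNear adj R dS k
  sparse k far with near-heavy-cover (proj₁ ordering k) far
  ... | L , length-L , cover = L , length-L , λ j → cover (proj₁ ordering j)
  open Greedy adj simple R ordering dS compatible sparse
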